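{- Let $n \geq m \geq 2$ and let $K_{n,m}$ be the complete bipartite graph with bipartition $(X,Y)$, where $|X|=n$ and $|Y|=m$. If $U$ is a strong edge geodetic set of $K_{n,m}$, then $X \subseteq U$ or $Y \subseteq U$.
   Context: All graphs are finite and simple. For a graph $G$, a set $S\subseteq V(G)$ is a strong edge geodetic set if to each (unordered) pair of vertices $u,v\in S$ one can assign one shortest $u,v$-path (or no path) such that every edge of $G$ lies on at least one of the assigned paths. -}

module Defs where

open import Data.Nat using (ℕ; zero; suc; _+_; _≤_; _<_)
open import Data.Fin using (Fin; toℕ)
open import Data.Fin.Subset using (Subset; _∈_)
open import Data.Maybe using (Maybe; just)
open import Data.Product using (Σ; ∃; _×_; _,_)
open import Data.Sum using (_⊎_)
open import Data.Empty using (⊥)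
open import Relation.Binary.PropositionalEquality using (_≡_)

record Graph (N : ℕ) : Set₁ where
  field
    Adj     : Fin N → Fin N → Set
    sym     : ∀ {x y} → Adj x y → Adj y x
    irrefl  : ∀ {x} → Adj x x → ⊥
open Graph public

data Walk {N : ℕ} (G : Graph N) : Fin N → Fin N → ℕ → Set where
  []  : ∀ {u} → Walk G u u 0
  _∷_ : ∀ {u w v k} → Adj G u w → Walk G w v k → Walk G u v (suc k)

data EdgeOn {N : ℕ} {G : Graph N} (x y : Fin N) :
       ∀ {u v k} → Walk G u v k → Set where
  here  : ∀ {u w v k} (e : Adj G u w) (p : Walk G w v k) →
          (x ≡ u × y ≡ w) ⊎ (x ≡ w × y ≡ u) → EdgeOn x y (e ∷ p)
  there : ∀ {u w v k} (e : Adj G u w) {p : Walk G w v k} →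
          EdgeOn x y p → EdgeOn x y (e ∷ p)

-- A shortest u,v-path: a u,v-walk of minimum length (such a walk is
-- necessarily a path).
record ShortestPath {N : ℕ} (G : Graph N) (u v : Fin N) : Set where
  constructor sp
  field
    len      : ℕ
    walk     : Walk G u v len
    shortest : ∀ {k} → Walk G u v k → len ≤ k
open ShortestPath public

-- Strong edge geodetic set: to each unordered pair {u,v} ⊆ S (represented
-- as toℕ u < toℕ v) one assigns one shortest u,v-path or no path, such that
-- every edge of G lies on at least one assigned path.
StrongEdgeGeodetic : ∀ {N} → Graph N → Subset N → Set
StrongEdgeGeodetic {N} G S =
  Σ ((u v : Fin N) → u ∈ S → v ∈ S → toℕ u < toℕ v → Maybe (ShortestPath G u v))
    λ assign → ∀ x y → Adj G x y →
      Σ (Fin N) λ u → Σ (Fin N) λ v → Σ (u ∈ S) λ uS → Σ (v ∈ S) λ vS →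
      Σ (toℕ u < toℕ v) λ lt → Σ (ShortestPath G u v) λ P →
        (assign u v uS vS lt ≡ just P) × EdgeOn x y (walk P)

-- Complete bipartite graph K_{n,m} on Fin (n + m):
-- X = vertices with toℕ < n (|X| = n), Y = the rest (|Y| = m).
InX : (n m : ℕ) → Fin (n + m) → Set
InX n m x = toℕ x < n

InY : (n m : ℕ) → Fin (n + m) → Set
InY n m x = n ≤ toℕ x

KAdj : (n m : ℕ) → Fin (n + m) → Fin (n + m) → Set
KAdj n m x y = (InX n m x × InY n m y) ⊎ (InY n m x × InX n m y)

private
  open import Data.Sum using (inj₁; inj₂)
  open import Data.Nat.Properties using (<⇒≱)

  ksym : ∀ {n m x y} → KAdj n m x y → KAdj n m y x
  ksym (inj₁ (a , b)) = inj₂ (b , a)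
  ksym (inj₂ (a , b)) = inj₁ (b , a)

  kirr : ∀ {n m x} → KAdj n m x x → ⊥
  kirr (inj₁ (a , b)) = <⇒≱ a b
  kirr (inj₂ (a , b)) = <⇒≱ b a

K : (n m : ℕ) → Graph (n + m)
K n m = record { Adj = KAdj n m ; sym = ksym ; irrefl = kirr }

-- An edge xy with x ∈ X ∖ U and y ∈ Y ∖ U would have to lie on an assigned
-- shortest path between two vertices of U. But K_{n,m} has diameter at most 2,
-- and every edge of a walk with at most two edges meets one of its ends; so x or
-- y would be an end of that path and hence lie in U.
module Submission where

open import Defs hiding (sym)
open import Data.Nat using (ℕ; _≤_; _+_; z≤n; s≤s; _<?_; _≤?_)
open import Data.Nat.Properties using (≤-trans; ≮⇒≥)
open import Data.Fin using (Fin; toℕ)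
open import Data.Fin.Subset using (Subset; _∈_)
open import Data.Fin.Subset.Properties using (_∈?_)
open import Data.Fin.Properties using (any?)
open import Data.Sum using (_⊎_; inj₁; inj₂)
open import Data.Product using (∃; _×_; _,_)
open import Relation.Nullary using (¬_; yes; no; contradiction)
open import Relation.Nullary.Decidable using (_×-dec_; ¬?)
open import Relation.Unary using (Pred; Decidable)
open import Relation.Binary.PropositionalEquality using (_≡_; subst; sym)

⊆⊎counterexample : ∀ {n p q} {P : Pred (Fin n) p} {Q : Pred (Fin n) q} →
  Decidable P → Decidable Q →
  (∀ x → P x → Q x) ⊎ ∃ λ x → P x × ¬ Q x
⊆⊎counterexample {P = P} {Q} P? Q? with any? (λ x → P? x ×-dec ¬? (Q? x))
... | yes counterexample = inj₂ counterexample
... | no ¬counterexample = inj₁ P⊆Q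
  where
  P⊆Q : ∀ x → P x → Q x
  P⊆Q x Px with Q? x
  ... | yes Qx = Qx
  ... | no ¬Qx = contradiction (x , Px , ¬Qx) ¬counterexample

edgeOn-short-walk⇒incident : ∀ {N} {G : Graph N} {x y u v k}
  (p : Walk G u v k) → k ≤ 2 → EdgeOn x y p →
  (x ≡ u ⊎ y ≡ u) ⊎ (x ≡ v ⊎ y ≡ v)
edgeOn-short-walk⇒incident _ _ (here _ _ (inj₁ (x≡u , _)))             = inj₁ (inj₁ x≡u)
edgeOn-short-walk⇒incident _ _ (here _ _ (inj₂ (_ , y≡u)))             = inj₁ (inj₂ y≡u)
edgeOn-short-walk⇒incident _ _ (there _ (here _ [] (inj₁ (_ , y≡v))))  = inj₂ (inj₂ y≡v)
edgeOn-short-walk⇒incident _ _ (there _ (here _ [] (inj₂ (x≡v , _))))  = inj₂ (inj₁ x≡v)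
edgeOn-short-walk⇒incident _ (s≤s (s≤s ())) (there _ (here _ (_ ∷ _) _))
edgeOn-short-walk⇒incident _ (s≤s (s≤s ())) (there _ (there _ (there _ _)))

short-geodesics⇒edge-meets-geodetic-set : ∀ {N} {G : Graph N} {S : Subset N} →
  (∀ {u v} (P : ShortestPath G u v) → len P ≤ 2) →
  StrongEdgeGeodetic G S → ∀ {x y} → Adj G x y → x ∈ S ⊎ y ∈ S
short-geodesics⇒edge-meets-geodetic-set {S = S} short (_ , cover) {x} {y} xy
  with cover x y xy
... | u , v , u∈S , v∈S , _ , P , _ , xy∈P
  with edgeOn-short-walk⇒incident (walk P) (short P) xy∈P
... | inj₁ (inj₁ x≡u) = inj₁ (subst (_∈ S) (sym x≡u) u∈S)
... | inj₁ (inj₂ y≡u) = inj₂ (subst (_∈ S) (sym y≡u) u∈S)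
... | inj₂ (inj₁ x≡v) = inj₁ (subst (_∈ S) (sym x≡v) v∈S)
... | inj₂ (inj₂ y≡v) = inj₂ (subst (_∈ S) (sym y≡v) v∈S)

K-walk≤2 : ∀ {n m x₀ y₀} → InX n m x₀ → InY n m y₀ →
  ∀ u v → ∃ λ k → k ≤ 2 × Walk (K n m) u v k
K-walk≤2 {n} x₀∈X y₀∈Y u v with toℕ u <? n | toℕ v <? n
... | yes u∈X | yes v∈X = 2 , s≤s (s≤s z≤n) , (inj₁ (u∈X , y₀∈Y) ∷ (inj₂ (y₀∈Y , v∈X) ∷ []))
... | yes u∈X | no  v∉X = 1 , s≤s z≤n , (inj₁ (u∈X , ≮⇒≥ v∉X) ∷ [])
... | no  u∉X | yes v∈X = 1 , s≤s z≤n , (inj₂ (≮⇒≥ u∉X , v∈X) ∷ [])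
... | no  u∉X | no  v∉X = 2 , s≤s (s≤s z≤n) , (inj₂ (≮⇒≥ u∉X , x₀∈X) ∷ (inj₁ (x₀∈X , ≮⇒≥ v∉X) ∷ []))

K-shortestPath-len≤2 : ∀ {n m x₀ y₀} → InX n m x₀ → InY n m y₀ →
  ∀ {u v} (P : ShortestPath (K n m) u v) → len P ≤ 2
K-shortestPath-len≤2 x₀∈X y₀∈Y {u} {v} P with K-walk≤2 x₀∈X y₀∈Y u v
... | _ , k≤2 , w = ≤-trans (shortest P w) k≤2

lemma2p2 : (n m : ℕ) → 2 ≤ m → m ≤ n → (U : Subset (n + m)) →
    StrongEdgeGeodetic (K n m) U →
    (∀ x → InX n m x → x ∈ U) ⊎ (∀ y → InY n m y → y ∈ U)
lemma2p2 n m _ _ U geodetic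
  with ⊆⊎counterexample (λ x → toℕ x <? n) (_∈? U) | ⊆⊎counterexample (λ y → n ≤? toℕ y) (_∈? U)
... | inj₁ X⊆U | _         = inj₁ X⊆U
... | inj₂ _   | inj₁ Y⊆U  = inj₂ Y⊆U
... | inj₂ (x , x∈X , x∉U) | inj₂ (y , y∈Y , y∉U)
  with short-geodesics⇒edge-meets-geodetic-set
         (K-shortestPath-len≤2 x∈X y∈Y) geodetic (inj₁ (x∈X , y∈Y))
... | inj₁ x∈U = contradiction x∈U x∉U
... | inj₂ y∈U = contradiction y∈U y∉U
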